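{- Let $C$ be an eulerian clutter on a finite vertex set $V$ such that $(\ast)$ for every $e\in C$, $e\not\subseteq\bigcup(C\setminus\{e\})$. Then $C$ is odd and the nerve $N(C)$ is the clique complex of the intersection graph $G(C)$, and $G(C)$ is a chordal graph.
   Context: A clutter $C$ on a finite set $V$ is a collection of subsets of $V$ (edges), each of size at least two, forming an antichain under inclusion; it is discrete if it has no edges. The restriction to $I\subseteq V$ is $C|_I=\{e\in C:e\subseteq I\}$. Let $\zeta(C)=1$ if $C$ is discrete and $0$ otherwise, $\epsilon(C)=1$ if $V=\emptyset$ and $0$ otherwise, and $\chi(C)=\sum_{I\subseteq V}(-1)^{|I|}\zeta(C|_I)\zeta(C|_{V\setminus I})$. $C$ is eulerian if $\chi(C|_I)=\epsilon(C|_I)$ for all $I\subseteq V$. The nerve of $C$ is the simplicial complex $N(C)=\{C'\subseteq C: \bigcap C'\neq\emptyset\}$ on vertex set $C$; the intersection graph $G(C)$ is its 1-skeleton (vertices the edges of $C$, adjacent when they intersect). $C$ is odd if $|\bigcap C'|$ is odd for every nonempty face $C'\in N(C)$. A graph is chordal if every cycle of length at least four has a chord; the clique complex of a graph is the simplicial complex of its cliques. -}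

module Defs where

open import Data.Bool using (Bool; true; false; if_then_else_)
open import Data.Nat using (ℕ; zero; suc; _≤_; _%_; _≟_)
open import Data.Integer as ℤ using (ℤ; -1ℤ; 0ℤ; 1ℤ)
open import Data.Fin using (Fin; toℕ)
open import Data.Fin.Properties using (any?)
open import Data.Fin.Subset
open import Data.Fin.Subset.Properties using (_⊆?_; _∈?_; nonempty?)
open import Data.List using (List; []; _∷_; _++_; map; filter; foldr; allFin)
open import Data.Vec using ([]; _∷_)
open import Data.Product using (Σ; ∃; ∃-syntax; _×_; _,_)
open import Data.Sum using (_⊎_)
open import Relation.Nullary using (¬_; ¬?; does)
open import Relation.Binary.PropositionalEquality using (_≡_; _≢_)

Edges : ℕ → ℕ → Set
Edges n m = Fin m → Subset n

IsClutter : ∀ {n m} → Edges n m → Set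
IsClutter {n} {m} E =
  (∀ i → 2 ≤ ∣ E i ∣) × (∀ i j → i ≢ j → ¬ (E i ⊆ E j))

allSubsets : (n : ℕ) → List (Subset n)
allSubsets zero = [] ∷ []
allSubsets (suc n) = map (outside ∷_) (allSubsets n) ++ map (inside ∷_) (allSubsets n)

sumℤ : List ℤ → ℤ
sumℤ = foldr ℤ._+_ 0ℤ

-- ζ(C|_I) : 1 if the restriction of C to I has no edge, 0 otherwise.
ζ : ∀ {n m} → Edges n m → Subset n → ℤ
ζ E I = if does (any? (λ i → E i ⊆? I)) then 0ℤ else 1ℤ

ε : ∀ {n} → Subset n → ℤ
ε J = if does (nonempty? J) then 0ℤ else 1ℤ

χ : ∀ {n m} → Edges n m → Subset n → ℤ
χ {n} E J = sumℤ (map term (allSubsets n))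
  where
  term : Subset n → ℤ
  term I = if does (I ⊆? J)
             then (-1ℤ ℤ.^ ∣ I ∣) ℤ.* ζ E I ℤ.* ζ E (J ─ I)
             else 0ℤ

IsEulerian : ∀ {n m} → Edges n m → Set
IsEulerian {n} E = ∀ (J : Subset n) → χ E J ≡ ε J

selected : ∀ {n m} → Edges n m → Subset m → List (Subset n)
selected {m = m} E S = map E (filter (_∈? S) (allFin m))

interOf : ∀ {n m} → Edges n m → Subset m → Subset n
interOf E S = ⋂ (selected E S)

unionOthers : ∀ {n m} → Edges n m → Fin m → Subset n
unionOthers {m = m} E i = ⋃ (map E (filter (λ j → ¬? (j Data.Fin.≟ i)) (allFin m)))

Star : ∀ {n m} → Edges n m → Set
Star E = ∀ i → ¬ (E i ⊆ unionOthers E i)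

NerveFace : ∀ {n m} → Edges n m → Subset m → Set
NerveFace E S = Nonempty (interOf E S)

Odd : ℕ → Set
Odd k = k % 2 ≡ 1

IsOdd : ∀ {n m} → Edges n m → Set
IsOdd {m = m} E = ∀ (S : Subset m) → Nonempty S → NerveFace E S → Odd ∣ interOf E S ∣

Adj : ∀ {n m} → Edges n m → Fin m → Fin m → Set
Adj E i j = i ≢ j × Nonempty (E i ∩ E j)

IsClique : ∀ {n m} → Edges n m → Subset m → Set
IsClique E S = ∀ i j → i ∈ S → j ∈ S → i ≢ j → Adj E i j

NerveIsCliqueComplex : ∀ {n m} → Edges n m → Set
NerveIsCliqueComplex {m = m} E =
  ∀ (S : Subset m) → Nonempty S → (NerveFace E S → IsClique E S) × (IsClique E S → NerveFace E S)

-- Consecutive positions a, b (in this order) on a cycle of length k, indexed by Fin k.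
Consec : (k : ℕ) → Fin k → Fin k → Set
Consec k a b = (suc (toℕ a) ≡ toℕ b) ⊎ ((suc (toℕ a) ≡ k) × (toℕ b ≡ 0))

IsCycle : ∀ {m} → (Fin m → Fin m → Set) → (k : ℕ) → (Fin k → Fin m) → Set
IsCycle R k c = (∀ a b → c a ≡ c b → a ≡ b) × (∀ a b → Consec k a b → R (c a) (c b))

HasChord : ∀ {m} → (Fin m → Fin m → Set) → (k : ℕ) → (Fin k → Fin m) → Set
HasChord R k c = ∃[ a ] ∃[ b ] (a ≢ b × ¬ Consec k a b × ¬ Consec k b a × R (c a) (c b))

IsChordal : ∀ {m} → (Fin m → Fin m → Set) → Set
IsChordal {m} R = ∀ (k : ℕ) → 4 ≤ k → (c : Fin k → Fin m) → IsCycle R k c → HasChord R k c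

-- Expanding ζ by inclusion–exclusion over subfamilies gives
--   χ(C|_J) = Σ_{A,B ⊆ C} (-1)^{|A|+|B|} Σ_{I ⊆ J} (-1)^{|I|} [⋃A ⊆ I] [⋃B ⊆ J ∖ I],
-- and the inner sum vanishes unless ⋃A and ⋃B partition J. For J = ⋃D with D connected in G(C),
-- the private vertices given by (∗) force {A, B} = {D, ∅}, so χ(C|_J) = (-1)^{|D|} ((-1)^{|J|} + 1);
-- as C is eulerian this vanishes, i.e. |⋃D| is odd. Since |X ∩ Y| ≡ |X| + |Y| + |X ∪ Y| (mod 2),
-- the intersection of a clique of G(C) is then odd, hence nonempty, which gives oddness and the
-- nerve. In a chordless cycle c₀ c₁ … c_{k-1} with k ≥ 4 the same parity rule makes
-- c₀ ∩ (c₁ ∪ … ∪ c_{k-1}) odd, although it is the disjoint union of the odd sets c₀ ∩ c₁ and c₀ ∩ c_{k-1}.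

module Submission where

open import Defs
open import Data.Bool using (Bool; true; false; if_then_else_; _∧_; _∨_; not)
open import Data.Bool.Properties using (∧-zeroʳ) renaming (_≟_ to _≟ᵇ_)
open import Data.Empty using (⊥-elim) renaming (⊥ to False)
open import Data.Fin as Fin using (Fin; zero; suc; inject₁; fromℕ; toℕ)
open import Data.Fin.Properties using (any?; toℕ-inject₁; toℕ-fromℕ; toℕ-injective)
open import Data.Fin.Subset
open import Data.Fin.Subset.Properties
open import Data.Integer as ℤ using (ℤ; -1ℤ; 0ℤ; 1ℤ; _+_; _*_)
open import Data.Integer.Properties as ℤ using ()
open import Data.Integer.Tactic.RingSolver using (solve-∀)
open import Algebra.Properties.CommutativeSemigroup ℤ.+-commutativeSemigroup using () renaming (interchange to +-interchange)
open import Data.List using (List; []; _∷_; _++_; map; allFin)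
open import Data.List.Membership.Propositional using () renaming (_∈_ to _∈ₗ_)
open import Data.List.Membership.Propositional.Properties using (∈-filter⁺; ∈-filter⁻; ∈-allFin; ∈-map⁺; ∈-map⁻)
open import Data.List.Properties using (map-++; map-∘)
import Data.List.Relation.Unary.Any as Any
open import Data.Nat as ℕ using (ℕ; zero; suc; _%_)
open import Data.Nat.DivMod using (%-distribˡ-+)
open import Data.Nat.Properties as ℕ using ()
open import Data.Product using (∃-syntax; _×_; _,_; proj₁; proj₂)
open import Data.Sum as Sum using (_⊎_; inj₁; inj₂)
open import Data.Vec using ([]; _∷_; here; there)
open import Data.Vec.Properties using (∷-injectiveʳ; ≡-dec)
open import Function using (_∘_; case_of_)
open import Relation.Binary.PropositionalEquality hiding (J)
open import Relation.Nullary using (¬_; ¬?; Dec; yes; no; does; contradiction; _×-dec_; _⊎-dec_)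
open import Relation.Nullary.Decidable using (dec-true)

open ≡-Reasoning

-- Sums over all subsets

∑ : ∀ n → (Subset n → ℤ) → ℤ
∑ zero    f = f []
∑ (suc n) f = ∑ n (f ∘ (outside ∷_)) + ∑ n (f ∘ (inside ∷_))

sumℤ-++ : ∀ xs ys → sumℤ (xs ++ ys) ≡ sumℤ xs + sumℤ ys
sumℤ-++ []       ys = sym (ℤ.+-identityˡ _)
sumℤ-++ (x ∷ xs) ys = trans (cong (x +_) (sumℤ-++ xs ys)) (sym (ℤ.+-assoc x _ _))

sumℤ-allSubsets : ∀ n (f : Subset n → ℤ) → sumℤ (map f (allSubsets n)) ≡ ∑ n f
sumℤ-allSubsets zero    f = ℤ.+-identityʳ _
sumℤ-allSubsets (suc n) f = begin
  sumℤ (map f (map (outside ∷_) xs ++ map (inside ∷_) xs))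
    ≡⟨ cong sumℤ (map-++ f (map (outside ∷_) xs) _) ⟩
  sumℤ (map f (map (outside ∷_) xs) ++ map f (map (inside ∷_) xs))
    ≡⟨ sumℤ-++ (map f (map (outside ∷_) xs)) _ ⟩
  sumℤ (map f (map (outside ∷_) xs)) + sumℤ (map f (map (inside ∷_) xs))
    ≡⟨ cong₂ (λ u v → sumℤ u + sumℤ v) (map-∘ xs) (map-∘ xs) ⟨
  sumℤ (map (f ∘ (outside ∷_)) xs) + sumℤ (map (f ∘ (inside ∷_)) xs)
    ≡⟨ cong₂ _+_ (sumℤ-allSubsets n _) (sumℤ-allSubsets n _) ⟩
  ∑ (suc n) f ∎
  where xs = allSubsets n

∑-cong : ∀ n {f g : Subset n → ℤ} → (∀ x → f x ≡ g x) → ∑ n f ≡ ∑ n g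
∑-cong zero    f≡g = f≡g []
∑-cong (suc n) f≡g = cong₂ _+_ (∑-cong n (f≡g ∘ (outside ∷_))) (∑-cong n (f≡g ∘ (inside ∷_)))

∑-zero : ∀ n {f : Subset n → ℤ} → (∀ x → f x ≡ 0ℤ) → ∑ n f ≡ 0ℤ
∑-zero zero    f≡0 = f≡0 []
∑-zero (suc n) f≡0 = cong₂ _+_ (∑-zero n (f≡0 ∘ (outside ∷_))) (∑-zero n (f≡0 ∘ (inside ∷_)))

∑-+ : ∀ n (f g : Subset n → ℤ) → ∑ n (λ x → f x + g x) ≡ ∑ n f + ∑ n g
∑-+ zero    f g = refl
∑-+ (suc n) f g = trans
  (cong₂ _+_ (∑-+ n (f ∘ (outside ∷_)) (g ∘ (outside ∷_))) (∑-+ n (f ∘ (inside ∷_)) (g ∘ (inside ∷_))))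
  (+-interchange (∑ n (f ∘ (outside ∷_))) (∑ n (g ∘ (outside ∷_))) (∑ n (f ∘ (inside ∷_))) (∑ n (g ∘ (inside ∷_))))

∑-*ˡ : ∀ n c (f : Subset n → ℤ) → ∑ n (λ x → c * f x) ≡ c * ∑ n f
∑-*ˡ zero    c f = refl
∑-*ˡ (suc n) c f = trans
  (cong₂ _+_ (∑-*ˡ n c (f ∘ (outside ∷_))) (∑-*ˡ n c (f ∘ (inside ∷_))))
  (sym (ℤ.*-distribˡ-+ c _ _))

∑-*ʳ : ∀ n c (f : Subset n → ℤ) → ∑ n (λ x → f x * c) ≡ ∑ n f * c
∑-*ʳ n c f = begin
  ∑ n (λ x → f x * c) ≡⟨ ∑-cong n (λ x → ℤ.*-comm (f x) c) ⟩
  ∑ n (λ x → c * f x) ≡⟨ ∑-*ˡ n c f ⟩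
  c * ∑ n f           ≡⟨ ℤ.*-comm c _ ⟩
  ∑ n f * c           ∎

∑-*-∑ : ∀ m k (f : Subset m → ℤ) (g : Subset k → ℤ) → ∑ m f * ∑ k g ≡ ∑ m (λ A → ∑ k (λ B → f A * g B))
∑-*-∑ m k f g = begin
  ∑ m f * ∑ k g                          ≡⟨ ∑-*ʳ m (∑ k g) f ⟨
  ∑ m (λ A → f A * ∑ k g)                ≡⟨ ∑-cong m (λ A → ∑-*ˡ k (f A) g) ⟨
  ∑ m (λ A → ∑ k (λ B → f A * g B))      ∎

∑-comm : ∀ n k (h : Subset n → Subset k → ℤ) → ∑ n (λ x → ∑ k (h x)) ≡ ∑ k (λ y → ∑ n (λ x → h x y))
∑-comm zero    k h = refl
∑-comm (suc n) k h = trans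
  (cong₂ _+_ (∑-comm n k (h ∘ (outside ∷_))) (∑-comm n k (h ∘ (inside ∷_))))
  (sym (∑-+ k _ _))

∑-single : ∀ n (f : Subset n → ℤ) x₀ → (∀ x → x ≢ x₀ → f x ≡ 0ℤ) → ∑ n f ≡ f x₀
∑-single zero    f [] _ = refl
∑-single (suc n) f (outside ∷ x₀) off = trans
  (cong₂ _+_ (∑-single n _ x₀ λ x x≢x₀ → off _ (x≢x₀ ∘ ∷-injectiveʳ)) (∑-zero n λ x → off _ λ ()))
  (ℤ.+-identityʳ _)
∑-single (suc n) f (inside ∷ x₀) off = trans
  (cong₂ _+_ (∑-zero n λ x → off _ λ ()) (∑-single n _ x₀ λ x x≢x₀ → off _ (x≢x₀ ∘ ∷-injectiveʳ)))
  (ℤ.+-identityˡ _)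

∑-pair : ∀ n (f : Subset n → ℤ) x₀ x₁ → x₀ ≢ x₁ →
  (∀ x → x ≢ x₀ → x ≢ x₁ → f x ≡ 0ℤ) → ∑ n f ≡ f x₀ + f x₁
∑-pair n f x₀ x₁ x₀≢x₁ off = begin
  ∑ n f                     ≡⟨ ∑-cong n split ⟩
  ∑ n (λ x → f₀ x + f₁ x)   ≡⟨ ∑-+ n f₀ f₁ ⟩
  ∑ n f₀ + ∑ n f₁           ≡⟨ cong₂ _+_ (∑-single n f₀ x₀ off₀) (∑-single n f₁ x₁ off₁) ⟩
  f₀ x₀ + f₁ x₁             ≡⟨ cong₂ _+_ at₀ at₁ ⟩
  f x₀ + f x₁               ∎
  where
  _≟ₛ_ : (x y : Subset n) → Dec (x ≡ y)
  _≟ₛ_ = ≡-dec _≟ᵇ_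
  f₀ f₁ : Subset n → ℤ
  f₀ x = if does (x ≟ₛ x₀) then f x else 0ℤ
  f₁ x = if does (x ≟ₛ x₀) then 0ℤ else f x
  split : ∀ x → f x ≡ f₀ x + f₁ x
  split x with x ≟ₛ x₀
  ... | yes _ = sym (ℤ.+-identityʳ _)
  ... | no  _ = sym (ℤ.+-identityˡ _)
  off₀ : ∀ x → x ≢ x₀ → f₀ x ≡ 0ℤ
  off₀ x x≢x₀ with x ≟ₛ x₀
  ... | yes x≡x₀ = contradiction x≡x₀ x≢x₀
  ... | no  _    = refl
  off₁ : ∀ x → x ≢ x₁ → f₁ x ≡ 0ℤ
  off₁ x x≢x₁ with x ≟ₛ x₀
  ... | yes _    = refl
  ... | no x≢x₀  = off x x≢x₀ x≢x₁
  at₀ : f₀ x₀ ≡ f x₀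
  at₀ with x₀ ≟ₛ x₀
  ... | yes _  = refl
  ... | no x≢x = contradiction refl x≢x
  at₁ : f₁ x₁ ≡ f x₁
  at₁ with x₁ ≟ₛ x₀
  ... | yes x₁≡x₀ = contradiction (sym x₁≡x₀) x₀≢x₁
  ... | no  _     = refl

-- The expansion of χ

𝟙 : Bool → ℤ
𝟙 true  = 1ℤ
𝟙 false = 0ℤ

𝟙-∧ : ∀ a b → 𝟙 (a ∧ b) ≡ 𝟙 a * 𝟙 b
𝟙-∧ false b = sym (ℤ.*-zeroˡ (𝟙 b))
𝟙-∧ true  b = sym (ℤ.*-identityˡ (𝟙 b))

sg : Bool → ℤ
sg outside = 1ℤ
sg inside  = -1ℤ

sign : ∀ {n} → Subset n → ℤ
sign p = -1ℤ ℤ.^ ∣ p ∣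

sign-∷ : ∀ {n} i (I : Subset n) → sign (i ∷ I) ≡ sg i * sign I
sign-∷ outside I = sym (ℤ.*-identityˡ (sign I))
sign-∷ inside  I = refl

sign-⊥ : ∀ n → sign (⊥ {n}) ≡ 1ℤ
sign-⊥ n = cong (-1ℤ ℤ.^_) (∣⊥∣≡0 n)

_⊆ᵇ_ : ∀ {n} → Subset n → Subset n → Bool
p ⊆ᵇ q = does (p ⊆? q)

_⊆₁_ : Bool → Bool → Bool
a ⊆₁ b = not a ∨ b

⊆ᵇ-∷ : ∀ {n} a b (A B : Subset n) → (a ∷ A) ⊆ᵇ (b ∷ B) ≡ (a ⊆₁ b) ∧ (A ⊆ᵇ B)
⊆ᵇ-∷ outside b       A B = refl
⊆ᵇ-∷ inside  outside A B = refl
⊆ᵇ-∷ inside  inside  A B = refl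

⊥⊆ᵇ : ∀ {n} (I : Subset n) → ⊥ ⊆ᵇ I ≡ true
⊥⊆ᵇ []      = refl
⊥⊆ᵇ (i ∷ I) = ⊥⊆ᵇ I

∪⊆ᵇ : ∀ {n} (X Y I : Subset n) → (X ∪ Y) ⊆ᵇ I ≡ X ⊆ᵇ I ∧ Y ⊆ᵇ I
∪⊆ᵇ []                []                []              = refl
∪⊆ᵇ (inside  ∷ X)     (y ∷ Y)           (outside ∷ I)   = refl
∪⊆ᵇ (outside ∷ X)     (inside  ∷ Y)     (outside ∷ I)   = sym (∧-zeroʳ _)
∪⊆ᵇ (outside ∷ X)     (outside ∷ Y)     (outside ∷ I)   = ∪⊆ᵇ X Y I
∪⊆ᵇ (inside  ∷ X)     (inside  ∷ Y)     (inside  ∷ I)   = ∪⊆ᵇ X Y I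
∪⊆ᵇ (inside  ∷ X)     (outside ∷ Y)     (inside  ∷ I)   = ∪⊆ᵇ X Y I
∪⊆ᵇ (outside ∷ X)     (inside  ∷ Y)     (inside  ∷ I)   = ∪⊆ᵇ X Y I
∪⊆ᵇ (outside ∷ X)     (outside ∷ Y)     (inside  ∷ I)   = ∪⊆ᵇ X Y I

⋃ₛ : ∀ {n m} → (Fin m → Subset n) → Subset m → Subset n
⋃ₛ {m = zero}  F []      = ⊥
⋃ₛ {m = suc m} F (b ∷ A) = (if b then F zero else ⊥) ∪ ⋃ₛ (F ∘ suc) A

-- The form ζ E I takes once any? has tested the first edge (b = [E 0 ⊆ I]).
ζ-cons : ∀ b a → (if b ∨ a then 0ℤ else 1ℤ) ≡ (if a then 0ℤ else 1ℤ) * (1ℤ + -1ℤ * 𝟙 b)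
ζ-cons false false = refl
ζ-cons false true  = refl
ζ-cons true  false = refl
ζ-cons true  true  = refl

-- ζ(C|_I) = ∏ᵢ (1 - [eᵢ ⊆ I]), multiplied out over the subfamilies A of C.
ζ-expansion : ∀ {n m} (E : Edges n m) I → ζ E I ≡ ∑ m (λ A → sign A * 𝟙 (⋃ₛ E A ⊆ᵇ I))
ζ-expansion {m = zero}  E I = sym (cong (λ b → 1ℤ * 𝟙 b) (⊥⊆ᵇ I))
ζ-expansion {m = suc m} E I = begin
  ζ E I                  ≡⟨ ζ-cons (E zero ⊆ᵇ I) _ ⟩
  ζ E' I * (1ℤ + c)      ≡⟨ cong (_* (1ℤ + c)) (ζ-expansion E' I) ⟩
  Z * (1ℤ + c)           ≡⟨ ℤ.*-distribˡ-+ Z 1ℤ c ⟩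
  Z * 1ℤ + Z * c         ≡⟨ cong₂ _+_ (ℤ.*-identityʳ Z) (trans (ℤ.*-comm Z c) (sym (∑-*ˡ m c _))) ⟩
  Z + ∑ m (λ A → c * (sign A * 𝟙 (⋃ₛ E' A ⊆ᵇ I)))
    ≡⟨ cong₂ _+_ (∑-cong m withoutFirst) (∑-cong m withFirst) ⟩
  ∑ (suc m) (λ A → sign A * 𝟙 (⋃ₛ E A ⊆ᵇ I)) ∎
  where
  E' = E ∘ suc
  e = 𝟙 (E zero ⊆ᵇ I)
  c = -1ℤ * e
  Z = ∑ m (λ A → sign A * 𝟙 (⋃ₛ E' A ⊆ᵇ I))
  withoutFirst : ∀ A → sign A * 𝟙 (⋃ₛ E' A ⊆ᵇ I) ≡ sign (outside ∷ A) * 𝟙 ((⊥ ∪ ⋃ₛ E' A) ⊆ᵇ I)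
  withoutFirst A = cong (λ X → sign A * 𝟙 (X ⊆ᵇ I)) (sym (∪-identityˡ _))
  withFirst : ∀ A → c * (sign A * 𝟙 (⋃ₛ E' A ⊆ᵇ I)) ≡ sign (inside ∷ A) * 𝟙 ((E zero ∪ ⋃ₛ E' A) ⊆ᵇ I)
  withFirst A = begin
    -1ℤ * e * (sign A * u)    ≡⟨ reorder e (sign A) u ⟩
    -1ℤ * sign A * (e * u)    ≡⟨ cong (-1ℤ * sign A *_) (trans (sym (𝟙-∧ (E zero ⊆ᵇ I) (⋃ₛ E' A ⊆ᵇ I)))
                                                                (cong 𝟙 (sym (∪⊆ᵇ (E zero) (⋃ₛ E' A) I)))) ⟩
    -1ℤ * sign A * 𝟙 ((E zero ∪ ⋃ₛ E' A) ⊆ᵇ I) ∎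
    where
    u = 𝟙 (⋃ₛ E' A ⊆ᵇ I)
    reorder : ∀ e s u → -1ℤ * e * (s * u) ≡ -1ℤ * s * (e * u)
    reorder = solve-∀

_─₁_ : Bool → Bool → Bool
j ─₁ inside  = outside
j ─₁ outside = j

─-∷ : ∀ {n} j i (J I : Subset n) → (j ∷ J) ─ (i ∷ I) ≡ (j ─₁ i) ∷ (J ─ I)
─-∷ j inside  J I = refl
─-∷ j outside J I = refl

𝟙-⊆ᵇ-∷ : ∀ {n} a b (A B : Subset n) → 𝟙 ((a ∷ A) ⊆ᵇ (b ∷ B)) ≡ 𝟙 (a ⊆₁ b) * 𝟙 (A ⊆ᵇ B)
𝟙-⊆ᵇ-∷ a b A B = trans (cong 𝟙 (⊆ᵇ-∷ a b A B)) (𝟙-∧ (a ⊆₁ b) (A ⊆ᵇ B))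

splitTerm : ∀ {n} → Subset n → Subset n → Subset n → Subset n → ℤ
splitTerm X Y J I = 𝟙 (I ⊆ᵇ J) * sign I * 𝟙 (X ⊆ᵇ I) * 𝟙 (Y ⊆ᵇ (J ─ I))

splitSum : ∀ {n} → Subset n → Subset n → Subset n → ℤ
splitSum {n} X Y J = ∑ n (splitTerm X Y J)

splitTerm₁ : Bool → Bool → Bool → Bool → ℤ
splitTerm₁ x y j i = 𝟙 (i ⊆₁ j) * sg i * 𝟙 (x ⊆₁ i) * 𝟙 (y ⊆₁ (j ─₁ i))

splitSum₁ : Bool → Bool → Bool → ℤ
splitSum₁ x y j = splitTerm₁ x y j outside + splitTerm₁ x y j inside

splitTerm-∷ : ∀ {n} x y j i (X Y J I : Subset n) →
  splitTerm (x ∷ X) (y ∷ Y) (j ∷ J) (i ∷ I) ≡ splitTerm₁ x y j i * splitTerm X Y J I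
splitTerm-∷ x y j i X Y J I = begin
  splitTerm (x ∷ X) (y ∷ Y) (j ∷ J) (i ∷ I)
    ≡⟨ cong₂ _*_ (cong₂ _*_ (cong₂ _*_ (𝟙-⊆ᵇ-∷ i j I J) (sign-∷ i I)) (𝟙-⊆ᵇ-∷ x i X I))
                 (trans (cong (λ D → 𝟙 ((y ∷ Y) ⊆ᵇ D)) (─-∷ j i J I)) (𝟙-⊆ᵇ-∷ y (j ─₁ i) Y (J ─ I))) ⟩
  𝟙 (i ⊆₁ j) * 𝟙 (I ⊆ᵇ J) * (sg i * sign I) * (𝟙 (x ⊆₁ i) * 𝟙 (X ⊆ᵇ I))
    * (𝟙 (y ⊆₁ (j ─₁ i)) * 𝟙 (Y ⊆ᵇ (J ─ I)))
    ≡⟨ reorder (𝟙 (i ⊆₁ j)) (𝟙 (I ⊆ᵇ J)) (sg i) (sign I)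
               (𝟙 (x ⊆₁ i)) (𝟙 (X ⊆ᵇ I)) (𝟙 (y ⊆₁ (j ─₁ i))) (𝟙 (Y ⊆ᵇ (J ─ I))) ⟩
  splitTerm₁ x y j i * splitTerm X Y J I ∎
  where
  reorder : ∀ a b c d e f g h → a * b * (c * d) * (e * f) * (g * h) ≡ a * c * e * g * (b * d * f * h)
  reorder = solve-∀

splitSum-∷ : ∀ {n} x y j (X Y J : Subset n) →
  splitSum (x ∷ X) (y ∷ Y) (j ∷ J) ≡ splitSum₁ x y j * splitSum X Y J
splitSum-∷ {n} x y j X Y J = begin
  ∑ n (λ I → splitTerm (x ∷ X) (y ∷ Y) (j ∷ J) (outside ∷ I))
    + ∑ n (λ I → splitTerm (x ∷ X) (y ∷ Y) (j ∷ J) (inside ∷ I))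
    ≡⟨ cong₂ _+_ (∑-cong n (splitTerm-∷ x y j outside X Y J)) (∑-cong n (splitTerm-∷ x y j inside X Y J)) ⟩
  ∑ n (λ I → splitTerm₁ x y j outside * splitTerm X Y J I)
    + ∑ n (λ I → splitTerm₁ x y j inside * splitTerm X Y J I)
    ≡⟨ cong₂ _+_ (∑-*ˡ n (splitTerm₁ x y j outside) (splitTerm X Y J))
                 (∑-*ˡ n (splitTerm₁ x y j inside) (splitTerm X Y J)) ⟩
  splitTerm₁ x y j outside * splitSum X Y J + splitTerm₁ x y j inside * splitSum X Y J
    ≡⟨ ℤ.*-distribʳ-+ (splitSum X Y J) (splitTerm₁ x y j outside) _ ⟨
  splitSum₁ x y j * splitSum X Y J ∎

splitSum-⊥ʳ : ∀ {n} (X : Subset n) → splitSum X ⊥ X ≡ sign X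
splitSum-⊥ʳ []            = refl
splitSum-⊥ʳ (outside ∷ X) = trans (splitSum-∷ outside outside outside X ⊥ X)
                                  (trans (ℤ.*-identityˡ _) (splitSum-⊥ʳ X))
splitSum-⊥ʳ (inside ∷ X)  = trans (splitSum-∷ inside outside inside X ⊥ X)
                                  (cong (-1ℤ *_) (splitSum-⊥ʳ X))

splitSum-⊥ˡ : ∀ {n} (X : Subset n) → splitSum ⊥ X X ≡ 1ℤ
splitSum-⊥ˡ []            = refl
splitSum-⊥ˡ (outside ∷ X) = trans (splitSum-∷ outside outside outside ⊥ X X)
                                  (trans (ℤ.*-identityˡ _) (splitSum-⊥ˡ X))
splitSum-⊥ˡ (inside ∷ X)  = trans (splitSum-∷ outside inside inside ⊥ X X)
                                  (trans (ℤ.*-identityˡ _) (splitSum-⊥ˡ X))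

record SplitsAt {n} (X Y J : Subset n) (v : Fin n) : Set where
  field
    covered  : v ∈ J → v ∈ X ⊎ v ∈ Y
    leftIn   : v ∈ X → v ∈ J
    rightIn  : v ∈ Y → v ∈ J
    disjoint : v ∈ X → v ∈ Y → False

splitsAt-head : ∀ {n} x y j {X Y J : Subset n} → splitSum₁ x y j ≢ 0ℤ → SplitsAt (x ∷ X) (y ∷ Y) (j ∷ J) zero
splitsAt-head outside outside outside _ = record { covered = λ (); leftIn = λ (); rightIn = λ (); disjoint = λ () }
splitsAt-head outside inside  inside  _ =
  record { covered = λ _ → inj₂ here; leftIn = λ (); rightIn = λ _ → here; disjoint = λ () }
splitsAt-head inside  outside inside  _ =
  record { covered = λ _ → inj₁ here; leftIn = λ _ → here; rightIn = λ (); disjoint = λ _ () }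
splitsAt-head outside outside inside  ≢0 = contradiction refl ≢0
splitsAt-head outside inside  outside ≢0 = contradiction refl ≢0
splitsAt-head inside  outside outside ≢0 = contradiction refl ≢0
splitsAt-head inside  inside  outside ≢0 = contradiction refl ≢0
splitsAt-head inside  inside  inside  ≢0 = contradiction refl ≢0

splitsAt-there : ∀ {n x y j} {X Y J : Subset n} {v} →
  SplitsAt X Y J v → SplitsAt (x ∷ X) (y ∷ Y) (j ∷ J) (suc v)
splitsAt-there s = record
  { covered  = Sum.map there there ∘ covered ∘ drop-there
  ; leftIn   = there ∘ leftIn ∘ drop-there
  ; rightIn  = there ∘ rightIn ∘ drop-there
  ; disjoint = λ vX vY → disjoint (drop-there vX) (drop-there vY)
  }
  where open SplitsAt s

splitSum≢0⇒splitsAt : ∀ {n} (X Y J : Subset n) → splitSum X Y J ≢ 0ℤ → ∀ v → SplitsAt X Y J v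
splitSum≢0⇒splitsAt (x ∷ X) (y ∷ Y) (j ∷ J) ≢0 zero = splitsAt-head x y j λ ≡0 →
  ≢0 (trans (splitSum-∷ x y j X Y J) (trans (cong (_* splitSum X Y J) ≡0) (ℤ.*-zeroˡ (splitSum X Y J))))
splitSum≢0⇒splitsAt (x ∷ X) (y ∷ Y) (j ∷ J) ≢0 (suc v) = splitsAt-there (splitSum≢0⇒splitsAt X Y J (λ ≡0 →
  ≢0 (trans (splitSum-∷ x y j X Y J) (trans (cong (splitSum₁ x y j *_) ≡0) (ℤ.*-zeroʳ (splitSum₁ x y j))))) v)

module _ {n m} (E : Edges n m) (J : Subset n) where

  private
    -- The summand of χ, repeated so that it can be named.
    χTerm : Subset n → ℤ
    χTerm I = if does (I ⊆? J) then (-1ℤ ℤ.^ ∣ I ∣) * ζ E I * ζ E (J ─ I) else 0ℤ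

    χTerm≡ : ∀ I → χTerm I ≡ 𝟙 (I ⊆ᵇ J) * sign I * ζ E I * ζ E (J ─ I)
    χTerm≡ I with I ⊆ᵇ J
    ... | true  = cong (λ s → s * ζ E I * ζ E (J ─ I)) (sym (ℤ.*-identityˡ (sign I)))
    ... | false = sym (trans (cong (_* ζ E (J ─ I)) (ℤ.*-zeroˡ (ζ E I))) (ℤ.*-zeroˡ (ζ E (J ─ I))))

    χTerm-expansion : ∀ I →
      χTerm I ≡ ∑ m (λ A → ∑ m (λ B → sign A * sign B * splitTerm (⋃ₛ E A) (⋃ₛ E B) J I))
    χTerm-expansion I = begin
      χTerm I                                       ≡⟨ χTerm≡ I ⟩
      c * ζ E I * ζ E (J ─ I)                       ≡⟨ cong₂ (λ u v → c * u * v)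
                                                         (ζ-expansion E I) (ζ-expansion E (J ─ I)) ⟩
      c * ∑ m f * ∑ m g                             ≡⟨ ℤ.*-assoc c (∑ m f) (∑ m g) ⟩
      c * (∑ m f * ∑ m g)                           ≡⟨ cong (c *_) (∑-*-∑ m m f g) ⟩
      c * ∑ m (λ A → ∑ m (λ B → f A * g B))         ≡⟨ ∑-*ˡ m c _ ⟨
      ∑ m (λ A → c * ∑ m (λ B → f A * g B))         ≡⟨ ∑-cong m (λ A → ∑-*ˡ m c _) ⟨
      ∑ m (λ A → ∑ m (λ B → c * (f A * g B)))       ≡⟨ ∑-cong m (λ A → ∑-cong m (λ B → reorder A B)) ⟩
      ∑ m (λ A → ∑ m (λ B → sign A * sign B * splitTerm (⋃ₛ E A) (⋃ₛ E B) J I)) ∎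
      where
      c = 𝟙 (I ⊆ᵇ J) * sign I
      f = λ A → sign A * 𝟙 (⋃ₛ E A ⊆ᵇ I)
      g = λ B → sign B * 𝟙 (⋃ₛ E B ⊆ᵇ (J ─ I))
      reorder : ∀ A B → c * (f A * g B) ≡ sign A * sign B * splitTerm (⋃ₛ E A) (⋃ₛ E B) J I
      reorder A B = ring (𝟙 (I ⊆ᵇ J)) (sign I) (sign A) (𝟙 (⋃ₛ E A ⊆ᵇ I)) (sign B) (𝟙 (⋃ₛ E B ⊆ᵇ (J ─ I)))
        where
        ring : ∀ a s p u q v → a * s * (p * u * (q * v)) ≡ p * q * (a * s * u * v)
        ring = solve-∀

  χ-expansion : χ E J ≡ ∑ m (λ A → ∑ m (λ B → sign A * sign B * splitSum (⋃ₛ E A) (⋃ₛ E B) J))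
  χ-expansion = begin
    χ E J                                          ≡⟨ sumℤ-allSubsets n χTerm ⟩
    ∑ n χTerm                                      ≡⟨ ∑-cong n χTerm-expansion ⟩
    ∑ n (λ I → ∑ m (λ A → ∑ m (λ B → h A B I)))    ≡⟨ ∑-comm n m _ ⟩
    ∑ m (λ A → ∑ n (λ I → ∑ m (λ B → h A B I)))    ≡⟨ ∑-cong m (λ A → ∑-comm n m (λ I B → h A B I)) ⟩
    ∑ m (λ A → ∑ m (λ B → ∑ n (h A B)))            ≡⟨ ∑-cong m (λ A → ∑-cong m (λ B →
                                                        ∑-*ˡ n (sign A * sign B) (splitTerm (⋃ₛ E A) (⋃ₛ E B) J))) ⟩
    ∑ m (λ A → ∑ m (λ B → sign A * sign B * splitSum (⋃ₛ E A) (⋃ₛ E B) J)) ∎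
    where
    h : Subset m → Subset m → Subset n → ℤ
    h A B I = sign A * sign B * splitTerm (⋃ₛ E A) (⋃ₛ E B) J I

-- Connected families have odd union

∈⋃ₛ⁺ : ∀ {n m} (F : Fin m → Subset n) {A x} i → i ∈ A → x ∈ F i → x ∈ ⋃ₛ F A
∈⋃ₛ⁺ F {inside ∷ A} zero    here     x∈Fi = x∈p∪q⁺ (inj₁ x∈Fi)
∈⋃ₛ⁺ F {b      ∷ A} (suc i) (there i∈A) x∈Fi = x∈p∪q⁺ (inj₂ (∈⋃ₛ⁺ (F ∘ suc) i i∈A x∈Fi))

∈⋃ₛ⁻ : ∀ {n m} (F : Fin m → Subset n) A {x} → x ∈ ⋃ₛ F A → ∃[ i ] (i ∈ A × x ∈ F i)
∈⋃ₛ⁻ {m = zero}  F []      x∈ = contradiction x∈ ∉⊥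
∈⋃ₛ⁻ {m = suc m} F (b ∷ A) x∈ with b | x∈p∪q⁻ (if b then F zero else ⊥) (⋃ₛ (F ∘ suc) A) x∈
... | inside  | inj₁ x∈F₀ = zero , here , x∈F₀
... | outside | inj₁ x∈⊥  = contradiction x∈⊥ ∉⊥
... | _       | inj₂ x∈⋃  with ∈⋃ₛ⁻ (F ∘ suc) A x∈⋃
...   | i , i∈A , x∈Fi = suc i , there i∈A , x∈Fi

⋃ₛ-⊥ : ∀ {n m} (F : Fin m → Subset n) → ⋃ₛ F ⊥ ≡ ⊥
⋃ₛ-⊥ {m = zero}  F = refl
⋃ₛ-⊥ {m = suc m} F = trans (∪-identityˡ _) (⋃ₛ-⊥ (F ∘ suc))

sign-parity : ∀ k → (Odd k × -1ℤ ℤ.^ k ≡ -1ℤ) ⊎ (k % 2 ≡ 0 × -1ℤ ℤ.^ k ≡ 1ℤ)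
sign-parity 0 = inj₂ (refl , refl)
sign-parity 1 = inj₁ (refl , refl)
sign-parity (suc (suc k)) with sign-parity k
... | inj₁ (odd  , s) = inj₁ (odd  , cong (λ z → -1ℤ * (-1ℤ * z)) s)
... | inj₂ (even , s) = inj₂ (even , cong (λ z → -1ℤ * (-1ℤ * z)) s)

sign-sum≡0⇒odd : ∀ a b → -1ℤ ℤ.^ a * -1ℤ ℤ.^ b + -1ℤ ℤ.^ a ≡ 0ℤ → Odd b
sign-sum≡0⇒odd a b eq with sign-parity b
... | inj₁ (odd , _) = odd
... | inj₂ (_ , sb) with sign-parity a
...   | inj₁ (_ , sa) = contradiction (trans (sym (cong₂ (λ u v → u * v + u) sa sb)) eq) λ ()
...   | inj₂ (_ , sa) = contradiction (trans (sym (cong₂ (λ u v → u * v + u) sa sb)) eq) λ ()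

Private : ∀ {n m} → Edges n m → Fin m → Fin n → Set
Private E i p = p ∈ E i × (∀ {j} → p ∈ E j → j ≡ i)

private∈⋃ₛ⇒∈ : ∀ {n m} (E : Edges n m) {i p} A → Private E i p → p ∈ ⋃ₛ E A → i ∈ A
private∈⋃ₛ⇒∈ E A (_ , only-i) p∈⋃ with ∈⋃ₛ⁻ E A p∈⋃
... | j , j∈A , p∈Ej = subst (_∈ A) (only-i p∈Ej) j∈A

x∈⋃⁺ : ∀ {n} (L : List (Subset n)) {x p} → p ∈ₗ L → x ∈ p → x ∈ ⋃ L
x∈⋃⁺ (q ∷ L) (Any.here refl) x∈p = x∈p∪q⁺ (inj₁ x∈p)
x∈⋃⁺ (q ∷ L) (Any.there p∈L) x∈p = x∈p∪q⁺ (inj₂ (x∈⋃⁺ L p∈L x∈p))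

privateVertex : ∀ {n m} (E : Edges n m) → Star E → ∀ i → ∃[ p ] Private E i p
privateVertex {m = m} E star i with any? (λ p → (p ∈? E i) ×-dec ¬? (p ∈? unionOthers E i))
... | yes (p , p∈Ei , p∉others) = p , p∈Ei , onlyIn
  where
  onlyIn : ∀ {j} → p ∈ E j → j ≡ i
  onlyIn {j} p∈Ej with j Fin.≟ i
  ... | yes j≡i = j≡i
  ... | no  j≢i = contradiction
    (x∈⋃⁺ _ (∈-map⁺ E (∈-filter⁺ (λ j → ¬? (j Fin.≟ i)) (∈-allFin j) j≢i)) p∈Ej) p∉others
... | no noPrivate = ⊥-elim (star i Ei⊆others)
  where
  Ei⊆others : E i ⊆ unionOthers E i
  Ei⊆others {x} x∈Ei with x ∈? unionOthers E i
  ... | yes x∈others = x∈others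
  ... | no  x∉others = contradiction (x , x∈Ei , x∉others) noPrivate

Connected : ∀ {n m} → Edges n m → Subset m → Set
Connected {m = m} E D = ∀ (A B : Subset m) → (∀ {i} → i ∈ D → i ∈ A ⊎ i ∈ B) →
  (∀ {i j} → i ∈ A → j ∈ B → Empty (E i ∩ E j)) → D ⊆ A ⊎ D ⊆ B

ε-nonempty : ∀ {n} {J : Subset n} → Nonempty J → ε J ≡ 0ℤ
ε-nonempty {J = J} J≢∅ rewrite dec-true (nonempty? J) J≢∅ = refl

module _ {n m} (E : Edges n m) (edge≢∅ : ∀ i → Nonempty (E i)) (hasPrivate : ∀ i → ∃[ p ] Private E i p)
         {D : Subset m} (D≢∅ : Nonempty D) (connected : Connected E D) where

  private
    J = ⋃ₛ E D

    meetsItself : ∀ i → Nonempty (E i ∩ E i)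
    meetsItself i = subst Nonempty (sym (∩-idem (E i))) (edge≢∅ i)

    module Split (A B : Subset m) (≢0 : splitSum (⋃ₛ E A) (⋃ₛ E B) J ≢ 0ℤ) where
      open module At v = SplitsAt (splitSum≢0⇒splitsAt (⋃ₛ E A) (⋃ₛ E B) J ≢0 v)

      ⊆D : ∀ C → (∀ {v} → v ∈ ⋃ₛ E C → v ∈ J) → C ⊆ D
      ⊆D C ⋃C⊆J {i} i∈C with hasPrivate i
      ... | p , p∈Ei , only-i = private∈⋃ₛ⇒∈ E D (p∈Ei , only-i) (⋃C⊆J (∈⋃ₛ⁺ E i i∈C p∈Ei))

      A⊆D : A ⊆ D
      A⊆D = ⊆D A (leftIn _)

      B⊆D : B ⊆ D
      B⊆D = ⊆D B (rightIn _)

      covers : ∀ {i} → i ∈ D → i ∈ A ⊎ i ∈ B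
      covers {i} i∈D with hasPrivate i
      ... | p , p∈Ei , only-i = Sum.map (private∈⋃ₛ⇒∈ E A (p∈Ei , only-i)) (private∈⋃ₛ⇒∈ E B (p∈Ei , only-i))
                                            (covered p (∈⋃ₛ⁺ E i i∈D p∈Ei))

      separated : ∀ {i j} → i ∈ A → j ∈ B → Empty (E i ∩ E j)
      separated {i} {j} i∈A j∈B (v , v∈) with x∈p∩q⁻ (E i) (E j) v∈
      ... | v∈Ei , v∈Ej = disjoint v (∈⋃ₛ⁺ E i i∈A v∈Ei) (∈⋃ₛ⁺ E j j∈B v∈Ej)

      trivial : (A ≡ D × B ≡ ⊥) ⊎ (A ≡ ⊥ × B ≡ D)
      trivial with connected A B covers separated
      ... | inj₁ D⊆A = inj₁ (⊆-antisym A⊆D D⊆A ,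
                             Empty-unique λ (j , j∈B) → separated (D⊆A (B⊆D j∈B)) j∈B (meetsItself j))
      ... | inj₂ D⊆B = inj₂ (Empty-unique (λ (i , i∈A) → separated i∈A (D⊆B (A⊆D i∈A)) (meetsItself i)) ,
                             ⊆-antisym B⊆D D⊆B)

    term : Subset m → Subset m → ℤ
    term A B = sign A * sign B * splitSum (⋃ₛ E A) (⋃ₛ E B) J

    term-vanishes : ∀ A B → ¬ ((A ≡ D × B ≡ ⊥) ⊎ (A ≡ ⊥ × B ≡ D)) → term A B ≡ 0ℤ
    term-vanishes A B nontrivial with splitSum (⋃ₛ E A) (⋃ₛ E B) J ℤ.≟ 0ℤ
    ... | yes ≡0 = trans (cong (sign A * sign B *_) ≡0) (ℤ.*-zeroʳ (sign A * sign B))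
    ... | no  ≢0 = contradiction (Split.trivial A B ≢0) nontrivial

    term-D⊥ : term D ⊥ ≡ sign D * sign J
    term-D⊥ = begin
      sign D * sign (⊥ {m}) * splitSum J (⋃ₛ E ⊥) J ≡⟨ cong₂ (λ s X → sign D * s * splitSum J X J)
                                                              (sign-⊥ m) (⋃ₛ-⊥ E) ⟩
      sign D * 1ℤ * splitSum J ⊥ J                  ≡⟨ cong₂ _*_ (ℤ.*-identityʳ (sign D)) (splitSum-⊥ʳ J) ⟩
      sign D * sign J                                ∎

    term-⊥D : term ⊥ D ≡ sign D
    term-⊥D = begin
      sign (⊥ {m}) * sign D * splitSum (⋃ₛ E ⊥) J J ≡⟨ cong₂ (λ s X → s * sign D * splitSum X J J)
                                                              (sign-⊥ m) (⋃ₛ-⊥ E) ⟩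
      1ℤ * sign D * splitSum ⊥ J J                  ≡⟨ cong₂ _*_ (ℤ.*-identityˡ (sign D)) (splitSum-⊥ˡ J) ⟩
      sign D * 1ℤ                                    ≡⟨ ℤ.*-identityʳ (sign D) ⟩
      sign D                                         ∎

    D≢⊥ : D ≢ ⊥
    D≢⊥ D≡⊥ = ∉⊥ (subst (proj₁ D≢∅ ∈_) D≡⊥ (proj₂ D≢∅))

    χ-⋃ₛ : χ E J ≡ sign D * sign J + sign D
    χ-⋃ₛ = begin
      χ E J                        ≡⟨ χ-expansion E J ⟩
      ∑ m (λ A → ∑ m (term A))     ≡⟨ ∑-pair m _ D ⊥ D≢⊥ (λ A A≢D A≢⊥ → ∑-zero m λ B →
                                        term-vanishes A B Sum.[ A≢D ∘ proj₁ , A≢⊥ ∘ proj₁ ]′) ⟩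
      ∑ m (term D) + ∑ m (term ⊥)  ≡⟨ cong₂ _+_
                                        (∑-single m (term D) ⊥ λ B B≢⊥ →
                                          term-vanishes D B Sum.[ B≢⊥ ∘ proj₂ , D≢⊥ ∘ proj₁ ]′)
                                        (∑-single m (term ⊥) D λ B B≢D →
                                          term-vanishes ⊥ B Sum.[ D≢⊥ ∘ sym ∘ proj₁ , B≢D ∘ proj₂ ]′) ⟩
      term D ⊥ + term ⊥ D          ≡⟨ cong₂ _+_ term-D⊥ term-⊥D ⟩
      sign D * sign J + sign D     ∎

    J≢∅ : Nonempty J
    J≢∅ with edge≢∅ (proj₁ D≢∅)
    ... | v , v∈E = v , ∈⋃ₛ⁺ E (proj₁ D≢∅) (proj₂ D≢∅) v∈E

  connected⇒odd-⋃ₛ : IsEulerian E → Odd ∣ ⋃ₛ E D ∣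
  connected⇒odd-⋃ₛ eulerian =
    sign-sum≡0⇒odd ∣ D ∣ ∣ J ∣ (trans (sym χ-⋃ₛ) (trans (eulerian J) (ε-nonempty J≢∅)))

-- Parity of intersections

∣p∩q∣+∣p∪q∣≡∣p∣+∣q∣ : ∀ {n} (p q : Subset n) → ∣ p ∩ q ∣ ℕ.+ ∣ p ∪ q ∣ ≡ ∣ p ∣ ℕ.+ ∣ q ∣
∣p∩q∣+∣p∪q∣≡∣p∣+∣q∣ []            []            = refl
∣p∩q∣+∣p∪q∣≡∣p∣+∣q∣ (outside ∷ p) (outside ∷ q) = ∣p∩q∣+∣p∪q∣≡∣p∣+∣q∣ p q
∣p∩q∣+∣p∪q∣≡∣p∣+∣q∣ (outside ∷ p) (inside  ∷ q) = begin
  ∣ p ∩ q ∣ ℕ.+ suc ∣ p ∪ q ∣ ≡⟨ ℕ.+-suc _ _ ⟩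
  suc (∣ p ∩ q ∣ ℕ.+ ∣ p ∪ q ∣) ≡⟨ cong suc (∣p∩q∣+∣p∪q∣≡∣p∣+∣q∣ p q) ⟩
  suc (∣ p ∣ ℕ.+ ∣ q ∣) ≡⟨ ℕ.+-suc _ _ ⟨
  ∣ p ∣ ℕ.+ suc ∣ q ∣ ∎
∣p∩q∣+∣p∪q∣≡∣p∣+∣q∣ (inside  ∷ p) (outside ∷ q) = trans (ℕ.+-suc _ _) (cong suc (∣p∩q∣+∣p∪q∣≡∣p∣+∣q∣ p q))
∣p∩q∣+∣p∪q∣≡∣p∣+∣q∣ (inside  ∷ p) (inside  ∷ q) =
  cong suc (trans (ℕ.+-suc _ _) (trans (cong suc (∣p∩q∣+∣p∪q∣≡∣p∣+∣q∣ p q)) (sym (ℕ.+-suc _ _))))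

odd+odd-even : ∀ a b → Odd a → Odd b → (a ℕ.+ b) % 2 ≡ 0
odd+odd-even a b oa ob = trans (%-distribˡ-+ a b 2) (cong₂ (λ u v → (u ℕ.+ v) % 2) oa ob)

odd-cancel : ∀ a b c d → a ℕ.+ b ≡ c ℕ.+ d → Odd b → Odd c → Odd d → Odd a
odd-cancel a b c d eq ob oc od with sign-parity a
... | inj₁ (oa , _) = oa
... | inj₂ (ea , _) = case trans (sym [a+b]%2≡1) (trans (cong (_% 2) eq) (odd+odd-even c d oc od)) of λ ()
  where
  [a+b]%2≡1 : (a ℕ.+ b) % 2 ≡ 1
  [a+b]%2≡1 = trans (%-distribˡ-+ a b 2) (cong₂ (λ u v → (u ℕ.+ v) % 2) ea ob)

odd-∩ : ∀ {n} (p q : Subset n) → Odd ∣ p ∣ → Odd ∣ q ∣ → Odd ∣ p ∪ q ∣ → Odd ∣ p ∩ q ∣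
odd-∩ p q odd-p odd-q odd-p∪q =
  odd-cancel (∣ p ∩ q ∣) (∣ p ∪ q ∣) (∣ p ∣) (∣ q ∣) (∣p∩q∣+∣p∪q∣≡∣p∣+∣q∣ p q) odd-p∪q odd-p odd-q

∣p∪q∣≡∣p∣+∣q∣ : ∀ {n} (p q : Subset n) → Empty (p ∩ q) → ∣ p ∪ q ∣ ≡ ∣ p ∣ ℕ.+ ∣ q ∣
∣p∪q∣≡∣p∣+∣q∣ {n} p q p∩q≡∅ = trans (cong (ℕ._+ ∣ p ∪ q ∣) (sym ∣p∩q∣≡0)) (∣p∩q∣+∣p∪q∣≡∣p∣+∣q∣ p q)
  where
  ∣p∩q∣≡0 : ∣ p ∩ q ∣ ≡ 0
  ∣p∩q∣≡0 = trans (cong ∣_∣ (Empty-unique p∩q≡∅)) (∣⊥∣≡0 n)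

∣p∣≢0⇒nonempty : ∀ {n} (p : Subset n) → ∣ p ∣ ≢ 0 → Nonempty p
∣p∣≢0⇒nonempty {n} p ∣p∣≢0 with nonempty? p
... | yes p≢∅ = p≢∅
... | no  p≡∅ = contradiction (trans (cong ∣_∣ (Empty-unique p≡∅)) (∣⊥∣≡0 n)) ∣p∣≢0

odd⇒≢0 : ∀ {k} → Odd k → k ≢ 0
odd⇒≢0 odd refl = case odd of λ ()

∩-nonempty-comm : ∀ {n} {p q : Subset n} → Nonempty (p ∩ q) → Nonempty (q ∩ p)
∩-nonempty-comm {p = p} {q} = subst Nonempty (∩-comm p q)

⋂ₛ : ∀ {n m} → (Fin m → Subset n) → Subset m → Subset n
⋂ₛ {m = zero}  F []      = ⊤
⋂ₛ {m = suc m} F (b ∷ A) = (if b then F zero else ⊤) ∩ ⋂ₛ (F ∘ suc) A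

∈⋂ₛ⁺ : ∀ {n m} (F : Fin m → Subset n) {A x} → (∀ {i} → i ∈ A → x ∈ F i) → x ∈ ⋂ₛ F A
∈⋂ₛ⁺ {m = zero}  F {[]}          _  = ∈⊤
∈⋂ₛ⁺ {m = suc m} F {outside ∷ A} x∈F = x∈p∩q⁺ (∈⊤ , ∈⋂ₛ⁺ (F ∘ suc) (x∈F ∘ there))
∈⋂ₛ⁺ {m = suc m} F {inside  ∷ A} x∈F = x∈p∩q⁺ (x∈F here , ∈⋂ₛ⁺ (F ∘ suc) (x∈F ∘ there))

∈⋂ₛ⁻ : ∀ {n m} (F : Fin m → Subset n) {A x i} → x ∈ ⋂ₛ F A → i ∈ A → x ∈ F i
∈⋂ₛ⁻ F {inside ∷ A} x∈ here        = proj₁ (x∈p∩q⁻ (F zero) _ x∈)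
∈⋂ₛ⁻ F {b      ∷ A} x∈ (there i∈A) = ∈⋂ₛ⁻ (F ∘ suc) (proj₂ (x∈p∩q⁻ (if b then F zero else ⊤) _ x∈)) i∈A

⋂ₛ-⊥ : ∀ {n m} (F : Fin m → Subset n) → ⋂ₛ F ⊥ ≡ ⊤
⋂ₛ-⊥ {m = zero}  F = refl
⋂ₛ-⊥ {m = suc m} F = trans (∩-identityˡ _) (⋂ₛ-⊥ (F ∘ suc))

⋃ₛ-∩ˡ : ∀ {n m} P (F : Fin m → Subset n) A → ⋃ₛ (λ t → P ∩ F t) A ≡ P ∩ ⋃ₛ F A
⋃ₛ-∩ˡ P F []            = sym (∩-zeroʳ P)
⋃ₛ-∩ˡ P F (outside ∷ A) = trans (∪-identityˡ _) (trans (⋃ₛ-∩ˡ P (F ∘ suc) A) (cong (P ∩_) (sym (∪-identityˡ _))))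
⋃ₛ-∩ˡ P F (inside  ∷ A) = trans (cong (P ∩ F zero ∪_) (⋃ₛ-∩ˡ P (F ∘ suc) A)) (sym (∩-distribˡ-∪ P (F zero) _))

⋂ₛ-∩ˡ : ∀ {n m} P (F : Fin m → Subset n) {A} → Nonempty A → ⋂ₛ (λ t → P ∩ F t) A ≡ P ∩ ⋂ₛ F A
⋂ₛ-∩ˡ P F (i , i∈A) = ⊆-antisym
  (λ x∈ → x∈p∩q⁺ (proj₁ (x∈p∩q⁻ P _ (∈⋂ₛ⁻ _ x∈ i∈A)) , ∈⋂ₛ⁺ F (proj₂ ∘ x∈p∩q⁻ P _ ∘ ∈⋂ₛ⁻ _ x∈)))
  (λ x∈ → ∈⋂ₛ⁺ _ (λ j∈A → x∈p∩q⁺ (proj₁ (x∈p∩q⁻ P _ x∈) , ∈⋂ₛ⁻ F (proj₂ (x∈p∩q⁻ P _ x∈)) j∈A)))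

-- Induction on m: if 0 ∈ S, replacing each F (suc t) by F 0 ∩ F (suc t) keeps the intersection,
-- and odd-∩ keeps the unions odd.
odd-⋃ₛ⇒odd-⋂ₛ : ∀ {n m} (F : Fin m → Subset n) {S} → Nonempty S →
  (∀ {T} → T ⊆ S → Nonempty T → Odd ∣ ⋃ₛ F T ∣) → Odd ∣ ⋂ₛ F S ∣
odd-⋃ₛ⇒odd-⋂ₛ {m = suc m} F {outside ∷ S} (suc i , there i∈S) odd⋃ =
  subst (λ p → Odd ∣ p ∣) (sym (∩-identityˡ (⋂ₛ (F ∘ suc) S)))
    (odd-⋃ₛ⇒odd-⋂ₛ (F ∘ suc) (i , i∈S) λ {T} T⊆S (j , j∈T) →
      subst (λ p → Odd ∣ p ∣) (∪-identityˡ (⋃ₛ (F ∘ suc) T)) (odd⋃ (out⊆ T⊆S) (suc j , there j∈T)))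
odd-⋃ₛ⇒odd-⋂ₛ {m = suc m} F {inside ∷ S} _ odd⋃ = byRest (nonempty? S)
  where
  F₀ = F zero
  oddF₀ : Odd ∣ F₀ ∣
  oddF₀ = subst (λ p → Odd ∣ p ∣) (trans (cong (F₀ ∪_) (⋃ₛ-⊥ (F ∘ suc))) (∪-identityʳ F₀))
            (odd⋃ (s⊆s (⊆-min S)) (zero , here))
  odd⋃∩ : ∀ {T} → T ⊆ S → Nonempty T → Odd ∣ ⋃ₛ (λ t → F₀ ∩ F (suc t)) T ∣
  odd⋃∩ {T} T⊆S (j , j∈T) = subst (λ p → Odd ∣ p ∣) (sym (⋃ₛ-∩ˡ F₀ (F ∘ suc) T))
    (odd-∩ F₀ X oddF₀ (subst (λ p → Odd ∣ p ∣) (∪-identityˡ X) (odd⋃ (out⊆ T⊆S) (suc j , there j∈T)))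
      (odd⋃ (s⊆s T⊆S) (zero , here)))
    where X = ⋃ₛ (F ∘ suc) T
  byRest : Dec (Nonempty S) → Odd ∣ F₀ ∩ ⋂ₛ (F ∘ suc) S ∣
  byRest (no S≡∅)  = subst (λ p → Odd ∣ p ∣) (sym (begin
    F₀ ∩ ⋂ₛ (F ∘ suc) S ≡⟨ cong (λ S → F₀ ∩ ⋂ₛ (F ∘ suc) S) (Empty-unique S≡∅) ⟩
    F₀ ∩ ⋂ₛ (F ∘ suc) ⊥ ≡⟨ cong (F₀ ∩_) (⋂ₛ-⊥ (F ∘ suc)) ⟩
    F₀ ∩ ⊤              ≡⟨ ∩-identityʳ F₀ ⟩
    F₀                  ∎)) oddF₀
  byRest (yes S≢∅) = subst (λ p → Odd ∣ p ∣) (⋂ₛ-∩ˡ F₀ (F ∘ suc) S≢∅)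
                       (odd-⋃ₛ⇒odd-⋂ₛ (λ t → F₀ ∩ F (suc t)) S≢∅ odd⋃∩)

x∈⋂⁺ : ∀ {n} (L : List (Subset n)) {x} → (∀ {p} → p ∈ₗ L → x ∈ p) → x ∈ ⋂ L
x∈⋂⁺ []      _      = ∈⊤
x∈⋂⁺ (q ∷ L) x∈all = x∈p∩q⁺ (x∈all (Any.here refl) , x∈⋂⁺ L (x∈all ∘ Any.there))

x∈⋂⁻ : ∀ {n} (L : List (Subset n)) {x p} → x ∈ ⋂ L → p ∈ₗ L → x ∈ p
x∈⋂⁻ (q ∷ L) x∈⋂ (Any.here refl) = proj₁ (x∈p∩q⁻ q (⋂ L) x∈⋂)
x∈⋂⁻ (q ∷ L) x∈⋂ (Any.there p∈L) = x∈⋂⁻ L (proj₂ (x∈p∩q⁻ q (⋂ L) x∈⋂)) p∈L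

interOf≡⋂ₛ : ∀ {n m} (E : Edges n m) S → interOf E S ≡ ⋂ₛ E S
interOf≡⋂ₛ {m = m} E S = ⊆-antisym
  (λ x∈ → ∈⋂ₛ⁺ E λ {i} i∈S → x∈⋂⁻ (selected E S) x∈ (∈-map⁺ E (∈-filter⁺ (_∈? S) (∈-allFin i) i∈S)))
  (λ x∈ → x∈⋂⁺ (selected E S) λ p∈ → case ∈-map⁻ E p∈ of λ where
    (i , i∈ , refl) → ∈⋂ₛ⁻ E x∈ (proj₂ (∈-filter⁻ (_∈? S) {xs = allFin m} i∈)))

-- Cliques, walks and cycles

Clique : ∀ {n m} → Edges n m → Subset m → Set
Clique E D = ∀ {i j} → i ∈ D → j ∈ D → Nonempty (E i ∩ E j)

nerveFace⇒clique : ∀ {n m} (E : Edges n m) {S} → NerveFace E S → Clique E S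
nerveFace⇒clique E {S} (x , x∈⋂) i∈S j∈S = x , x∈p∩q⁺ (∈⋂ₛ⁻ E x∈⋂ₛ i∈S , ∈⋂ₛ⁻ E x∈⋂ₛ j∈S)
  where x∈⋂ₛ = subst (x ∈_) (interOf≡⋂ₛ E S) x∈⋂

clique⇒connected : ∀ {n m} (E : Edges n m) {D} → Clique E D → Connected E D
clique⇒connected E {D} clique A B covers separated with nonempty? (D ∩ A)
... | yes (i , i∈D∩A) = inj₁ λ j∈D → case covers j∈D of λ where
  (inj₁ j∈A) → j∈A
  (inj₂ j∈B) → let (i∈D , i∈A) = x∈p∩q⁻ D A i∈D∩A in contradiction (clique i∈D j∈D) (separated i∈A j∈B)
... | no D∩A≡∅ = inj₂ λ {j} j∈D → case covers j∈D of λ where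
  (inj₁ j∈A) → contradiction (j , x∈p∩q⁺ (j∈D , j∈A)) D∩A≡∅
  (inj₂ j∈B) → j∈B

image : ∀ {m r} → (Fin r → Fin m) → Subset m
image {r = zero}  f = ⊥
image {r = suc r} f = ⁅ f zero ⁆ ∪ image (f ∘ suc)

∈-image⁺ : ∀ {m r} (f : Fin r → Fin m) t → f t ∈ image f
∈-image⁺ f zero    = x∈p∪q⁺ (inj₁ (x∈⁅x⁆ (f zero)))
∈-image⁺ f (suc t) = x∈p∪q⁺ (inj₂ (∈-image⁺ (f ∘ suc) t))

∈-image⁻ : ∀ {m r} (f : Fin r → Fin m) {i} → i ∈ image f → ∃[ t ] f t ≡ i
∈-image⁻ {r = zero}  f i∈ = contradiction i∈ ∉⊥
∈-image⁻ {r = suc r} f i∈ with x∈p∪q⁻ ⁅ f zero ⁆ (image (f ∘ suc)) i∈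
... | inj₁ i∈⁅f₀⁆ = zero , sym (x∈⁅y⁆⇒x≡y (f zero) i∈⁅f₀⁆)
... | inj₂ i∈rest with ∈-image⁻ (f ∘ suc) i∈rest
...   | t , ft≡i = suc t , ft≡i

∈⋃ₛ-image⁻ : ∀ {n m r} (E : Edges n m) (f : Fin r → Fin m) {x} → x ∈ ⋃ₛ E (image f) → ∃[ t ] x ∈ E (f t)
∈⋃ₛ-image⁻ E f x∈ with ∈⋃ₛ⁻ E (image f) x∈
... | i , i∈ , x∈Ei with ∈-image⁻ f i∈
...   | t , refl = t , x∈Ei

⋃ₛ-image-∷ : ∀ {n m r} (E : Edges n m) (f : Fin (suc r) → Fin m) →
  ⋃ₛ E (image f) ≡ E (f zero) ∪ ⋃ₛ E (image (f ∘ suc))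
⋃ₛ-image-∷ E f = ⊆-antisym
  (λ x∈ → case ∈⋃ₛ-image⁻ E f x∈ of λ where
    (zero  , x∈E) → x∈p∪q⁺ (inj₁ x∈E)
    (suc t , x∈E) → x∈p∪q⁺ (inj₂ (∈⋃ₛ⁺ E (f (suc t)) (∈-image⁺ (f ∘ suc) t) x∈E)))
  (λ x∈ → case x∈p∪q⁻ (E (f zero)) _ x∈ of λ where
    (inj₁ x∈E) → ∈⋃ₛ⁺ E (f zero) (∈-image⁺ f zero) x∈E
    (inj₂ x∈⋃) → let (t , x∈E) = ∈⋃ₛ-image⁻ E (f ∘ suc) x∈⋃ in ∈⋃ₛ⁺ E (f (suc t)) (∈-image⁺ f (suc t)) x∈E)

Walk : ∀ {n m r} → Edges n m → (Fin (suc r) → Fin m) → Set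
Walk E f = ∀ t → Nonempty (E (f (inject₁ t)) ∩ E (f (suc t)))

walk-confined : ∀ {n m r} (E : Edges n m) (f : Fin (suc r) → Fin m) → Walk E f → ∀ {A B} →
  (∀ t → f t ∈ A ⊎ f t ∈ B) → (∀ {i j} → i ∈ A → j ∈ B → Empty (E i ∩ E j)) → f zero ∈ A → ∀ t → f t ∈ A
walk-confined E f walk covers separated f₀∈A zero = f₀∈A
walk-confined {r = suc r} E f walk covers separated f₀∈A (suc t) =
  walk-confined E (f ∘ suc) (walk ∘ suc) (covers ∘ suc) separated f₁∈A t
  where
  f₁∈A = case covers (suc zero) of λ where
    (inj₁ f₁∈A) → f₁∈A
    (inj₂ f₁∈B) → contradiction (walk zero) (separated f₀∈A f₁∈B)

image-⊆ : ∀ {m r} (f : Fin r → Fin m) {A} → (∀ t → f t ∈ A) → image f ⊆ A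
image-⊆ f all i∈ with ∈-image⁻ f i∈
... | t , refl = all t

walk⇒connected : ∀ {n m r} (E : Edges n m) (f : Fin (suc r) → Fin m) → Walk E f → Connected E (image f)
walk⇒connected E f walk A B covers separated with covers (∈-image⁺ f zero)
... | inj₁ f₀∈A = inj₁ (image-⊆ f (walk-confined E f walk (covers ∘ ∈-image⁺ f) separated f₀∈A))
... | inj₂ f₀∈B = inj₂ (image-⊆ f (walk-confined E f walk (Sum.swap ∘ covers ∘ ∈-image⁺ f)
                                    (λ i∈B j∈A → separated j∈A i∈B ∘ ∩-nonempty-comm) f₀∈B))

consec? : ∀ k a b → Dec (Consec k a b)
consec? k a b = (suc (toℕ a) ℕ.≟ toℕ b) ⊎-dec ((suc (toℕ a) ℕ.≟ k) ×-dec (toℕ b ℕ.≟ 0))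

adj? : ∀ {n m} (E : Edges n m) i j → Dec (Adj E i j)
adj? E i j = ¬? (i Fin.≟ j) ×-dec nonempty? (E i ∩ E j)

module _ {n m} (E : Edges n m) (clutter : IsClutter E) (eulerian : IsEulerian E) (star : Star E) where

  private
    edge≢∅ : ∀ i → Nonempty (E i)
    edge≢∅ i = ∣p∣≢0⇒nonempty (E i) λ ∣Ei∣≡0 → case subst (2 ℕ.≤_) ∣Ei∣≡0 (proj₁ clutter i) of λ ()

    connected⇒odd : ∀ {D} → Nonempty D → Connected E D → Odd ∣ ⋃ₛ E D ∣
    connected⇒odd D≢∅ connected = connected⇒odd-⋃ₛ E edge≢∅ (privateVertex E star) D≢∅ connected eulerian

    walk⇒odd : ∀ {r} (f : Fin (suc r) → Fin m) → Walk E f → Odd ∣ ⋃ₛ E (image f) ∣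
    walk⇒odd f walk = connected⇒odd (f zero , ∈-image⁺ f zero) (walk⇒connected E f walk)

    odd-edge : ∀ i → Odd ∣ E i ∣
    odd-edge i = subst (λ p → Odd ∣ p ∣) ⋃≡ (walk⇒odd point λ ())
      where
      point : Fin 1 → Fin m
      point _ = i
      ⋃≡ : ⋃ₛ E (image point) ≡ E i
      ⋃≡ = begin
        ⋃ₛ E (image point)  ≡⟨ ⋃ₛ-image-∷ E point ⟩
        E i ∪ ⋃ₛ E ⊥        ≡⟨ cong (E i ∪_) (⋃ₛ-⊥ E) ⟩
        E i ∪ ⊥             ≡⟨ ∪-identityʳ (E i) ⟩
        E i                 ∎

    odd-meet : ∀ {i j} → Nonempty (E i ∩ E j) → Odd ∣ E i ∩ E j ∣
    odd-meet {i} {j} meet =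
      odd-∩ (E i) (E j) (odd-edge i) (odd-edge j) (subst (λ p → Odd ∣ p ∣) ⋃≡ (walk⇒odd path λ { zero → meet }))
      where
      path : Fin 2 → Fin m
      path zero    = i
      path (suc _) = j
      ⋃≡ : ⋃ₛ E (image path) ≡ E i ∪ E j
      ⋃≡ = begin
        ⋃ₛ E (image path)                  ≡⟨ ⋃ₛ-image-∷ E path ⟩
        E i ∪ ⋃ₛ E (image (path ∘ suc))    ≡⟨ cong (E i ∪_) (⋃ₛ-image-∷ E (path ∘ suc)) ⟩
        E i ∪ E j ∪ ⋃ₛ E ⊥                 ≡⟨ cong (λ p → E i ∪ E j ∪ p) (⋃ₛ-⊥ E) ⟩
        E i ∪ E j ∪ ⊥                      ≡⟨ cong (E i ∪_) (∪-identityʳ (E j)) ⟩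
        E i ∪ E j                          ∎

    clique⇒odd-⋂ₛ : ∀ {S} → Nonempty S → Clique E S → Odd ∣ ⋂ₛ E S ∣
    clique⇒odd-⋂ₛ S≢∅ clique = odd-⋃ₛ⇒odd-⋂ₛ E S≢∅ λ T⊆S T≢∅ →
      connected⇒odd T≢∅ (clique⇒connected E λ i∈T j∈T → clique (T⊆S i∈T) (T⊆S j∈T))

    noHole : ∀ {r} (c : Fin (suc (suc r)) → Fin m) → Walk E c →
      Nonempty (E (c zero) ∩ E (c (fromℕ (suc r)))) →
      (∀ t → t ≢ zero → t ≢ fromℕ r → Empty (E (c zero) ∩ E (c (suc t)))) →
      Empty (E (c (suc zero)) ∩ E (c (fromℕ (suc r)))) → False
    noHole {r} c walk closing c₀-only-ends ends-disjoint =
      contradiction (subst (λ p → Odd ∣ p ∣) e∩X≡P∪Q odd-e∩X)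
        λ odd-P∪Q → case trans (sym odd-P∪Q) (trans (cong (_% 2) (∣p∪q∣≡∣p∣+∣q∣ P Q P∩Q≡∅))
                                 (odd+odd-even (∣ P ∣) (∣ Q ∣) (odd-meet (walk zero)) (odd-meet closing))) of λ ()
      where
      e = E (c zero)
      X = ⋃ₛ E (image (c ∘ suc))
      P = e ∩ E (c (suc zero))
      Q = e ∩ E (c (fromℕ (suc r)))
      odd-e∩X : Odd ∣ e ∩ X ∣
      odd-e∩X = odd-∩ e X (odd-edge (c zero)) (walk⇒odd (c ∘ suc) (walk ∘ suc))
                  (subst (λ p → Odd ∣ p ∣) (⋃ₛ-image-∷ E c) (walk⇒odd c walk))
      P∩Q≡∅ : Empty (P ∩ Q)
      P∩Q≡∅ (x , x∈P∩Q) with x∈p∩q⁻ P Q x∈P∩Q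
      ... | x∈P , x∈Q = ends-disjoint (x , x∈p∩q⁺ (proj₂ (x∈p∩q⁻ e _ x∈P) , proj₂ (x∈p∩q⁻ e _ x∈Q)))
      e∩X⊆P∪Q : e ∩ X ⊆ P ∪ Q
      e∩X⊆P∪Q {x} x∈ with x∈p∩q⁻ e X x∈
      ... | x∈e , x∈X with ∈⋃ₛ-image⁻ E (c ∘ suc) x∈X
      ...   | t , x∈Ect with t Fin.≟ zero | t Fin.≟ fromℕ r
      ...     | yes refl | _        = x∈p∪q⁺ (inj₁ (x∈p∩q⁺ (x∈e , x∈Ect)))
      ...     | no _     | yes refl = x∈p∪q⁺ (inj₂ (x∈p∩q⁺ (x∈e , x∈Ect)))
      ...     | no t≢0   | no t≢r   = contradiction (x , x∈p∩q⁺ (x∈e , x∈Ect)) (c₀-only-ends t t≢0 t≢r)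
      P∪Q⊆e∩X : P ∪ Q ⊆ e ∩ X
      P∪Q⊆e∩X x∈ = case x∈p∪q⁻ P Q x∈ of λ where
        (inj₁ x∈P) → x∈p∩q⁺ (proj₁ (x∈p∩q⁻ e _ x∈P) , ∈⋃ₛ⁺ E _ (∈-image⁺ (c ∘ suc) zero) (proj₂ (x∈p∩q⁻ e _ x∈P)))
        (inj₂ x∈Q) → x∈p∩q⁺ (proj₁ (x∈p∩q⁻ e _ x∈Q) , ∈⋃ₛ⁺ E _ (∈-image⁺ (c ∘ suc) (fromℕ r)) (proj₂ (x∈p∩q⁻ e _ x∈Q)))
      e∩X≡P∪Q : e ∩ X ≡ P ∪ Q
      e∩X≡P∪Q = ⊆-antisym e∩X⊆P∪Q P∪Q⊆e∩X

  chordless-absurd : ∀ k → 4 ℕ.≤ k → (c : Fin k → Fin m) → (∀ a b → Consec k a b → Adj E (c a) (c b)) →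
    (∀ a b → a ≢ b → ¬ Consec k a b → ¬ Consec k b a → Empty (E (c a) ∩ E (c b))) → False
  chordless-absurd (suc (suc (suc (suc r)))) (ℕ.s≤s (ℕ.s≤s (ℕ.s≤s (ℕ.s≤s _)))) c adjacent nonAdjacent =
    noHole c walk closing c₀-only-ends ends-disjoint
    where
    last = fromℕ (suc (suc r))
    walk : Walk E c
    walk t = proj₂ (adjacent (inject₁ t) (suc t) (inj₁ (cong suc (toℕ-inject₁ t))))
    closing : Nonempty (E (c zero) ∩ E (c (suc last)))
    closing = ∩-nonempty-comm (proj₂ (adjacent (suc last) zero
                (inj₂ (cong (λ i → suc (suc i)) (toℕ-fromℕ (suc (suc r))) , refl))))
    c₀-only-ends : ∀ t → t ≢ zero → t ≢ last → Empty (E (c zero) ∩ E (c (suc t)))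
    c₀-only-ends t t≢0 t≢last = nonAdjacent zero (suc t) (λ ())
      (λ { (inj₁ 1≡1+t) → t≢0 (toℕ-injective (sym (ℕ.suc-injective 1≡1+t))) ; (inj₂ (() , _)) })
      (λ { (inj₁ ()) ; (inj₂ (2+t≡k , _)) →
           t≢last (toℕ-injective (trans (ℕ.suc-injective (ℕ.suc-injective 2+t≡k))
                                        (sym (toℕ-fromℕ (suc (suc r)))))) })
    ends-disjoint : Empty (E (c (suc zero)) ∩ E (c (suc last)))
    ends-disjoint = nonAdjacent (suc zero) (suc last) (λ ())
      (λ { (inj₁ ()) ; (inj₂ (() , _)) }) (λ { (inj₁ ()) ; (inj₂ (_ , ())) })

  isOdd : IsOdd E
  isOdd S S≢∅ face = subst (λ p → Odd ∣ p ∣) (sym (interOf≡⋂ₛ E S)) (clique⇒odd-⋂ₛ S≢∅ (nerveFace⇒clique E face))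

  nerveIsCliqueComplex : NerveIsCliqueComplex E
  nerveIsCliqueComplex S S≢∅ = face⇒clique , clique⇒face
    where
    face⇒clique : NerveFace E S → IsClique E S
    face⇒clique face i j i∈S j∈S i≢j = i≢j , nerveFace⇒clique E face i∈S j∈S
    clique⇒face : IsClique E S → NerveFace E S
    clique⇒face clique = subst Nonempty (sym (interOf≡⋂ₛ E S))
      (∣p∣≢0⇒nonempty (⋂ₛ E S) (odd⇒≢0 (clique⇒odd-⋂ₛ S≢∅ meets)))
      where
      meets : Clique E S
      meets {i} {j} i∈S j∈S with i Fin.≟ j
      ... | yes refl = subst Nonempty (sym (∩-idem (E i))) (edge≢∅ i)
      ... | no  i≢j  = proj₂ (clique i j i∈S j∈S i≢j)

  isChordal : IsChordal (Adj E)
  isChordal k 4≤k c cycle with any? (λ a → any? (λ b →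
    ¬? (a Fin.≟ b) ×-dec ¬? (consec? k a b) ×-dec ¬? (consec? k b a) ×-dec adj? E (c a) (c b)))
  ... | yes chord   = chord
  ... | no  noChord = ⊥-elim (chordless-absurd k 4≤k c (proj₂ cycle) nonAdjacent)
    where
    nonAdjacent : ∀ a b → a ≢ b → ¬ Consec k a b → ¬ Consec k b a → Empty (E (c a) ∩ E (c b))
    nonAdjacent a b a≢b ¬ab ¬ba meet = noChord (a , b , a≢b , ¬ab , ¬ba , a≢b ∘ proj₁ cycle a b , meet)

mainTheorem4 : ∀ (n m : ℕ) (E : Edges n m) →
    IsClutter E → IsEulerian E → Star E →
    IsOdd E × NerveIsCliqueComplex E × IsChordal (Adj E)
mainTheorem4 n m E clutter eulerian star =
  isOdd E clutter eulerian star , nerveIsCliqueComplex E clutter eulerian star , isChordal E clutter eulerian star
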